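{- There is $c_0$ such that for every integer $c\geq c_0$ there exists a graph $G$ of type $G_c$ with $\alpha(G)<4c$ and $\omega(G)<4c$.
   Context: A red-blue graph is a graph each of whose edges is colored red or blue. For a red-blue graph $H$, a simple graph $G$ is of type $H$ if $V(G)=V(H)$, every blue edge of $H$ is an edge of $G$, and no red edge of $H$ is an edge of $G$ (pairs not joined in $H$ are arbitrary). The red-blue graph $G_c$ has as vertices all binary sequences of length at least $1$ and at most $c$, except that sequences of length exactly $c$ must end with $0$. For vertices $a=a_1\dots a_k$ and $b=b_1\dots b_l$ with $k\leq l$: if $k=l$ they are not adjacent; if $k<l$ they are adjacent iff $a_i=b_i$ for all $i<k$, and then the edge is blue if $a_k=b_k$ and red if $a_k\neq b_k$. $\alpha$ and $\omega$ denote independence number and clique number. -}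

module Defs where

open import Data.Bool using (Bool; true; false; not)
open import Data.Nat using (ℕ; _≤_; _<_; _*_)
open import Data.List using (List; []; _∷_; _++_; [_]; length)
open import Data.List.Relation.Unary.All using (All)
open import Data.List.Relation.Unary.AllPairs using (AllPairs)
open import Data.List.Relation.Unary.Unique.Propositional using (Unique)
open import Data.Product using (_×_; ∃)
open import Relation.Binary.PropositionalEquality using (_≡_)

-- Vertices of G_c : binary sequences (List Bool) of length between 1 and c;
-- those of length exactly c end with 0 (= false).
IsVertex : ℕ → List Bool → Set
IsVertex c s = (1 ≤ length s) × (length s ≤ c) × (length s ≡ c → ∃ λ p → s ≡ p ++ [ false ])

-- Blue edge of G_c between a = a₁…a_k and a longer b = b₁…b_l (k < l):
-- a_i = b_i for i < k and a_k = b_k.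
data BlueRel : List Bool → List Bool → Set where
  blue : ∀ p x r rs → BlueRel (p ++ [ x ]) (p ++ x ∷ r ∷ rs)

-- Red edge of G_c between a and a longer b: a_i = b_i for i < k and a_k ≠ b_k.
data RedRel : List Bool → List Bool → Set where
  red : ∀ p x r rs → RedRel (p ++ [ x ]) (p ++ not x ∷ r ∷ rs)

record SimpleGraph : Set where
  field
    adj   : List Bool → List Bool → Bool
    sym   : ∀ a b → adj a b ≡ adj b a
    irrefl : ∀ a → adj a a ≡ false

open SimpleGraph public

-- G is of type G_c: every blue edge of G_c is an edge of G, no red edge is.
-- (Edges are unordered; BlueRel/RedRel list the shorter endpoint first,
--  and symmetry of adj covers the other orientation.)
IsOfTypeGc : ℕ → SimpleGraph → Set
IsOfTypeGc c G =
  (∀ a b → IsVertex c a → IsVertex c b → BlueRel a b → adj G a b ≡ true) ×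
  (∀ a b → IsVertex c a → IsVertex c b → RedRel a b → adj G a b ≡ false)

IsIndependent : ℕ → SimpleGraph → List (List Bool) → Set
IsIndependent c G S = All (IsVertex c) S × Unique S × AllPairs (λ a b → adj G a b ≡ false) S

IsClique : ℕ → SimpleGraph → List (List Bool) → Set
IsClique c G S = All (IsVertex c) S × Unique S × AllPairs (λ a b → adj G a b ≡ true) S

AlphaLt : ℕ → SimpleGraph → ℕ → Set
AlphaLt c G n = ∀ S → IsIndependent c G S → length S < n

OmegaLt : ℕ → SimpleGraph → ℕ → Set
OmegaLt c G n = ∀ S → IsClique c G S → length S < n

module Submission where

-- The proof is the probabilistic method, made constructive.  Pairs of vertices
-- that G_c constrains get their forced colour; every other ("free") pair gets an
-- independent fair coin χ.  A set T of t = 4c vertices can only be homogeneous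
-- of colour β if no pair of T is forced to the opposite colour, and then it is
-- homogeneous exactly when all its free pairs get colour β.  A vertex v is
-- forced against at most |v| - 1 words, so T has at least
-- C(t,2) - Σ_{v ∈ T} (|v| - 1) free pairs and is homogeneous with probability at
-- most 2^(-C(t,2)) Π_{v ∈ T} 2^(|v| - 1).  Summing over all t-tuples and both
-- colours gives at most 2 (Σ_v 2^(|v| - 1))^t ≤ 2^((2c - 1) t + 1) < 2^C(t,2).

open import Data.Bool using (Bool; true; false; not; if_then_else_)
open import Data.Bool.Properties using () renaming (_≟_ to _≟B_; ≤-decTotalOrder to Bool-≤-decTotalOrder)
open import Data.Empty using (⊥; ⊥-elim)
open import Data.List using (List; []; _∷_; _++_; [_]; length; map; filter; mapMaybe; concatMap; take; cartesianProduct)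
open import Data.List.Membership.Propositional using (_∈_)
open import Data.List.Membership.Propositional.Properties using (∈-map⁺; ∈-++⁺ˡ; ∈-++⁺ʳ; ∈-concatMap⁺; ∈-filter⁺; ∈-cartesianProduct⁺; ∈-cartesianProduct⁻)
open import Data.List.Properties using (length-++; length-map; length-filter; length-removeAt′; length-take; filter-all; map-++; map-∘) renaming (≡-dec to List-≡-dec)
open import Data.List.Relation.Binary.Lex.NonStrict using () renaming (≤-decTotalOrder to Lex-≤-decTotalOrder)
open import Data.List.Relation.Binary.Pointwise using (Pointwise-≡⇒≡)
open import Data.List.Relation.Binary.Sublist.Heterogeneous.Properties using (length-mono-≤)
open import Data.List.Relation.Binary.Sublist.Propositional using (_⊆_; []; _∷_; _∷ʳ_; ⊆-refl)
open import Data.List.Relation.Binary.Sublist.Propositional.Properties using (All-resp-⊆)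
open import Data.List.Relation.Unary.All as All using (All; []; _∷_)
import Data.List.Relation.Unary.All.Properties as All
open import Data.List.Relation.Unary.AllPairs as AllPairs using (AllPairs; []; _∷_)
import Data.List.Relation.Unary.AllPairs.Properties as AllPairs
open import Data.List.Relation.Unary.Any as Any using (here; there; _─_; index)
open import Data.List.Relation.Unary.Unique.DecPropositional (List-≡-dec _≟B_) using (unique?)
open import Data.List.Relation.Unary.Unique.Propositional using (Unique)
open import Data.Maybe as Maybe using (Maybe; just; nothing)
open import Data.Maybe.Properties using (just-injective) renaming (≡-dec to Maybe-≡-dec)
import Data.Maybe.Relation.Unary.All as MaybeAll
import Data.Maybe.Relation.Unary.All.Properties as MaybeAll
import Data.Maybe.Relation.Unary.Any as MaybeAny
open import Data.Nat using (ℕ; zero; suc; _+_; _*_; _∸_; _^_; _≤_; _<_; z≤n; s≤s; s≤s⁻¹; _<?_)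
open import Data.Nat.ListAction using (sum; product)
open import Data.Nat.ListAction.Properties using (sum-++)
open import Data.Nat.Properties
open import Algebra.Properties.CommutativeSemigroup +-commutativeSemigroup using () renaming (interchange to +-interchange; x∙yz≈y∙xz to +-left-comm)
open import Data.Nat.Tactic.RingSolver using (solve-∀)
open import Data.Product using (_×_; _,_; proj₁; proj₂; ∃; ∃-syntax)
open import Data.Product.Properties using () renaming (≡-dec to ×-≡-dec)
open import Data.Sum using (_⊎_; inj₁; inj₂; [_,_]′)
open import Function using (_∘_)
open import Relation.Binary.Bundles using (DecTotalOrder)
open import Relation.Binary.Definitions using (DecidableEquality)
open import Relation.Binary.PropositionalEquality using (_≡_; _≢_; refl; sym; trans; cong; cong₂; subst; module ≡-Reasoning)
open import Relation.Nullary using (¬_; Dec; yes; no; does)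
open import Relation.Nullary.Decidable using (_×-dec_; _⊎-dec_)
open import Relation.Unary using (Decidable)

open import Defs hiding (sym; irrefl)

private
  variable
    A : Set

count : {P : A → Set} → Decidable P → List A → ℕ
count P? xs = length (filter P? xs)

module _ {P : A → Set} (P? : Decidable P) where

  count-≤-∷ : ∀ x xs → count P? xs ≤ count P? (x ∷ xs)
  count-≤-∷ x xs with does (P? x)
  ... | true  = n≤1+n (count P? xs)
  ... | false = ≤-refl

  count-all : ∀ {xs} → All P xs → count P? xs ≡ length xs
  count-all all = cong length (filter-all P? all)

  count-≤ : ∀ xs → count P? xs ≤ length xs
  count-≤ = length-filter P?

count-⊎ : {P Q : A → Set} (P? : Decidable P) (Q? : Decidable Q) →
          ∀ xs → count (λ x → P? x ⊎-dec Q? x) xs ≤ count P? xs + count Q? xs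
count-⊎ P? Q? [] = z≤n
count-⊎ P? Q? (x ∷ xs) with does (P? x) | does (Q? x) | count-⊎ P? Q? xs
... | true  | true  | ih = s≤s (≤-trans ih (+-monoʳ-≤ (count P? xs) (n≤1+n (count Q? xs))))
... | true  | false | ih = s≤s ih
... | false | true  | ih = subst (suc (count (λ y → P? y ⊎-dec Q? y) xs) ≤_) (sym (+-suc (count P? xs) (count Q? xs))) (s≤s ih)
... | false | false | ih = ih

module _ {x : A} where
  ∈-─ : ∀ {ys z} (x∈ys : x ∈ ys) → z ∈ ys → z ≢ x → z ∈ (ys ─ x∈ys)
  ∈-─ (here refl) (here refl) z≢x = ⊥-elim (z≢x refl)
  ∈-─ (here refl) (there z∈ys) _  = z∈ys
  ∈-─ (there x∈ys) (here refl) _  = here refl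
  ∈-─ (there x∈ys) (there z∈ys) z≢x = there (∈-─ x∈ys z∈ys z≢x)

unique-⊆-length : ∀ {xs ys : List A} → Unique xs → All (_∈ ys) xs → length xs ≤ length ys
unique-⊆-length {xs = []} [] [] = z≤n
unique-⊆-length {xs = x ∷ xs} {ys} (x∉xs ∷ uniq) (x∈ys ∷ xs⊆ys) =
  subst (suc (length xs) ≤_) (sym (length-removeAt′ ys (index x∈ys)))
    (s≤s (unique-⊆-length uniq (All.zipWith (λ (z∈ys , x≢z) → ∈-─ x∈ys z∈ys (x≢z ∘ sym)) (xs⊆ys , x∉xs))))

module _ (f : A → ℕ) where

  sum-map-++ : ∀ xs ys → sum (map f (xs ++ ys)) ≡ sum (map f xs) + sum (map f ys)
  sum-map-++ xs ys rewrite map-++ f xs ys = sum-++ (map f xs) (map f ys)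

  sum-map-const : ∀ {n xs} → All (λ x → f x ≡ n) xs → sum (map f xs) ≡ length xs * n
  sum-map-const [] = refl
  sum-map-const (fx≡n ∷ all) = cong₂ _+_ fx≡n (sum-map-const all)

  sum-map-filter : {P : A → Set} (P? : Decidable P) → ∀ xs → sum (map f (filter P? xs)) ≤ sum (map f xs)
  sum-map-filter P? [] = z≤n
  sum-map-filter P? (x ∷ xs) with does (P? x)
  ... | true  = +-monoʳ-≤ (f x) (sum-map-filter P? xs)
  ... | false = ≤-trans (sum-map-filter P? xs) (m≤n+m _ (f x))

^-sum : ∀ m (f : A → ℕ) xs → m ^ sum (map f xs) ≡ product (map (λ x → m ^ f x) xs)
^-sum m f [] = refl
^-sum m f (x ∷ xs) = trans (^-distribˡ-+-* m (f x) (sum (map f xs))) (cong (m ^ f x *_) (^-sum m f xs))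

sum-map-mono : {f g : A → ℕ} → ∀ {xs} → All (λ x → f x ≤ g x) xs → sum (map f xs) ≤ sum (map g xs)
sum-map-mono [] = z≤n
sum-map-mono (fx≤gx ∷ all) = +-mono-≤ fx≤gx (sum-map-mono all)

AllPairs-resp-⊆ : {R : A → A → Set} {xs ys : List A} → xs ⊆ ys → AllPairs R ys → AllPairs R xs
AllPairs-resp-⊆ [] [] = []
AllPairs-resp-⊆ (y ∷ʳ xs⊆ys) (_ ∷ rys) = AllPairs-resp-⊆ xs⊆ys rys
AllPairs-resp-⊆ (refl ∷ xs⊆ys) (ry ∷ rys) = All-resp-⊆ xs⊆ys ry ∷ AllPairs-resp-⊆ xs⊆ys rys

module _ {B : Set} {P : B → Set} where

  All-mapMaybe-∷ : (f : A → Maybe B) → ∀ x xs → All P (mapMaybe f (x ∷ xs)) →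
                   MaybeAll.All P (f x) × All P (mapMaybe f xs)
  All-mapMaybe-∷ f x xs all with f x
  ... | nothing = MaybeAll.nothing , all
  ... | just y  = MaybeAll.just (All.head all) , All.tail all

  All-if-just : ∀ c {x} → P x → MaybeAll.All P (if c then just x else nothing)
  All-if-just true  px = MaybeAll.just px
  All-if-just false px = MaybeAll.nothing

  Any-if-same : ∀ b {x} → P x → MaybeAny.Any P (if does (b ≟B b) then just x else nothing)
  Any-if-same true  px = MaybeAny.just px
  Any-if-same false px = MaybeAny.just px

  All-Any-contradiction : ∀ {m} → MaybeAll.All (λ y → ¬ P y) m → MaybeAny.Any P m → ⊥
  All-Any-contradiction (MaybeAll.just ¬py) (MaybeAny.just py) = ¬py py

tuples : List A → ℕ → List (List A)
tuples V zero    = [ [] ]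
tuples V (suc n) = concatMap (λ v → map (v ∷_) (tuples V n)) V

tuples-complete : ∀ {V : List A} {T} → All (_∈ V) T → T ∈ tuples V (length T)
tuples-complete [] = here refl
tuples-complete {V = V} {v ∷ T} (v∈V ∷ T⊆V) =
  ∈-concatMap⁺ (λ w → map (w ∷_) (tuples V (length T))) (Any.map (λ where refl → ∈-map⁺ (v ∷_) (tuples-complete T⊆V)) v∈V)

tuples-sound : ∀ (V : List A) n → All (λ T → All (_∈ V) T × length T ≡ n) (tuples V n)
tuples-sound V zero    = ([] , refl) ∷ []
tuples-sound V (suc n) =
  All.concat⁺ (All.map⁺ (All.tabulate (λ v∈V → All.map⁺ (All.map (λ (T⊆V , |T|≡n) → (v∈V ∷ T⊆V) , cong suc |T|≡n) (tuples-sound V n)))))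

sum-product-tuples : (w : A → ℕ) → ∀ V n → sum (map (product ∘ map w) (tuples V n)) ≡ sum (map w V) ^ n
sum-product-tuples w V zero    = refl
sum-product-tuples w V (suc n) = trans (extend V) (cong (sum (map w V) *_) (sum-product-tuples w V n))
  where
  Ts = tuples V n
  prepend : ∀ v Ts → sum (map (product ∘ map w) (map (v ∷_) Ts)) ≡ w v * sum (map (product ∘ map w) Ts)
  prepend v []       = sym (*-zeroʳ (w v))
  prepend v (T ∷ Ts) = trans (cong (w v * product (map w T) +_) (prepend v Ts)) (sym (*-distribˡ-+ (w v) _ _))
  extend : ∀ W → sum (map (product ∘ map w) (concatMap (λ v → map (v ∷_) Ts) W)) ≡ sum (map w W) * sum (map (product ∘ map w) Ts)
  extend []      = refl
  extend (v ∷ W) = trans (sum-map-++ (product ∘ map w) (map (v ∷_) Ts) (concatMap (λ v → map (v ∷_) Ts) W))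
    (trans (cong₂ _+_ (prepend v Ts) (extend W)) (sym (*-distribʳ-+ _ (w v) (sum (map w W)))))

half-below : ∀ {a b w n} → a + b ≤ w + w → w < n → a < n ⊎ b < n
half-below {a} {b} {w} {n} a+b≤2w w<n with a <? n
... | yes a<n = inj₁ a<n
... | no  a≮n = inj₂ (+-cancelˡ-< n b n (begin-strict
      n + b ≤⟨ +-monoˡ-≤ b (≮⇒≥ a≮n) ⟩
      a + b ≤⟨ a+b≤2w ⟩
      w + w <⟨ +-mono-< w<n w<n ⟩
      n + n ∎))
  where open ≤-Reasoning

-- Avoiding a family of events by fixing the variables one at a time.
--
-- Keys are boolean variables; an event is a conjunction of literals
-- "key k has value b", with pairwise distinct keys.  For a budget M ≥ |ev|,
-- weight M ev = 2^(M - |ev|) is 2^M times the probability of ev under a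
-- uniformly random assignment.  If the total weight of a finite family is
-- below 2^M, some assignment satisfies none of the events (union bound).  The
-- assignment is found constructively by the method of conditional
-- probabilities: the families conditioned on e = false and on e = true weigh
-- twice the family together, so one of them still weighs less than 2^M, and
-- we recurse on the remaining keys.
module EventAvoidance {Key : Set} (_≟_ : DecidableEquality Key) where

  Literal : Set
  Literal = Key × Bool

  Event : Set
  Event = List Literal

  Holds : (Key → Bool) → Event → Set
  Holds χ ev = All (λ (k , b) → χ k ≡ b) ev

  DistinctKeys : Event → Set
  DistinctKeys = AllPairs (λ l l′ → proj₁ l ≢ proj₁ l′)

  weight : ℕ → Event → ℕ
  weight M ev = 2 ^ (M ∸ length ev)

  totalWeight : ℕ → List Event → ℕ
  totalWeight M evs = sum (map (weight M) evs)

  WellFormed : List Key → ℕ → Event → Set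
  WellFormed E M ev = length ev ≤ M × DistinctKeys ev × All (λ l → proj₁ l ∈ E) ev

  restrict : Key → Bool → Event → Maybe Event
  restrict e b [] = just []
  restrict e b ((k , b′) ∷ ev) with k ≟ e
  ... | yes _ = if does (b′ ≟B b) then just ev else nothing
  ... | no  _ = Maybe.map ((k , b′) ∷_) (restrict e b ev)

  condition : Key → Bool → List Event → List Event
  condition e b = mapMaybe (restrict e b)

  set : Key → Bool → (Key → Bool) → Key → Bool
  set e b χ k = if does (k ≟ e) then b else χ k

  set-≢ : ∀ {e b χ k} → e ≢ k → set e b χ k ≡ χ k
  set-≢ {e} {k = k} e≢k with k ≟ e
  ... | yes refl = ⊥-elim (e≢k refl)
  ... | no  _    = refl

  holds-unset : ∀ {e b χ ev} → All (λ l → e ≢ proj₁ l) ev → Holds (set e b χ) ev → Holds χ ev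
  holds-unset {e} {b} {χ} no-e holds =
    All.zipWith (λ (e≢k , χ′k≡b′) → trans (sym (set-≢ {e} {b} {χ} e≢k)) χ′k≡b′) (no-e , holds)

  module _ {e : Key} {b : Bool} where

    restrict-⊆ : ∀ ev → MaybeAll.All (_⊆ ev) (restrict e b ev)
    restrict-⊆ [] = MaybeAll.just []
    restrict-⊆ ((k , b′) ∷ ev) with k ≟ e
    ... | yes _ = All-if-just (does (b′ ≟B b)) ((k , b′) ∷ʳ ⊆-refl)
    ... | no  _ = MaybeAll.map⁺ (MaybeAll.map (refl ∷_) (restrict-⊆ ev))

    restrict-avoids-key : ∀ {ev} → DistinctKeys ev →
                          MaybeAll.All (All (λ l → e ≢ proj₁ l)) (restrict e b ev)
    restrict-avoids-key {[]} [] = MaybeAll.just []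
    restrict-avoids-key {(k , b′) ∷ ev} (k∉ev ∷ distinct) with k ≟ e
    ... | yes refl = All-if-just (does (b′ ≟B b)) k∉ev
    ... | no  k≢e  = MaybeAll.map⁺ (MaybeAll.map ((k≢e ∘ sym) ∷_) (restrict-avoids-key distinct))

    restrict-wellFormed : ∀ {E M ev} → WellFormed (e ∷ E) M ev →
                          MaybeAll.All (WellFormed E M) (restrict e b ev)
    restrict-wellFormed {E} {M} {ev} (|ev|≤M , distinct , keys) =
      MaybeAll.zipWith wellFormed (restrict-⊆ ev , restrict-avoids-key distinct)
      where
      wellFormed : ∀ {ev′} → ev′ ⊆ ev × All (λ l → e ≢ proj₁ l) ev′ → WellFormed E M ev′
      wellFormed (ev′⊆ev , no-e) =
        ≤-trans (length-mono-≤ ev′⊆ev) |ev|≤M ,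
        AllPairs-resp-⊆ ev′⊆ev distinct ,
        All.zipWith (λ where (here refl , e≢e) → ⊥-elim (e≢e refl)
                             (there k∈E , _)   → k∈E)
                    (All-resp-⊆ ev′⊆ev keys , no-e)

    restrict-holds : ∀ {χ ev} → DistinctKeys ev → Holds (set e b χ) ev →
                     MaybeAny.Any (Holds χ) (restrict e b ev)
    restrict-holds {χ} {[]} [] [] = MaybeAny.just []
    restrict-holds {χ} {(k , b′) ∷ ev} (k∉ev ∷ distinct) (head ∷ holds) with k ≟ e
    ... | yes refl rewrite head = Any-if-same b′ (holds-unset k∉ev holds)
    ... | no  _ with restrict e b ev | restrict-holds distinct holds
    ...   | just ev′ | MaybeAny.just h = MaybeAny.just (head ∷ h)

  weightᴹ : ℕ → Maybe Event → ℕ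
  weightᴹ M (just ev) = weight M ev
  weightᴹ M nothing   = 0

  weight-suc : ∀ {M} ev → length ev ≤ M → weight (suc M) ev ≡ weight M ev + weight M ev
  weight-suc {M} ev |ev|≤M rewrite +-∸-assoc 1 |ev|≤M = cong (weight M ev +_) (+-identityʳ _)

  weightᴹ-∷ : ∀ M l m → weightᴹ (suc M) (Maybe.map (l ∷_) m) ≡ weightᴹ M m
  weightᴹ-∷ M l (just _) = refl
  weightᴹ-∷ M l nothing  = refl

  -- The two restrictions of an event weigh exactly twice the event: if e does
  -- not occur both are the event itself, otherwise one is impossible and the
  -- other is one literal shorter.
  restrict-weight : ∀ e M ev → length ev ≤ M →
    weightᴹ M (restrict e false ev) + weightᴹ M (restrict e true ev) ≡ weight M ev + weight M ev
  restrict-weight e M [] _ = refl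
  restrict-weight e (suc M) ((k , b′) ∷ ev) (s≤s |ev|≤M) with k ≟ e
  ... | yes _ = split b′
    where
    split : ∀ b′ → weightᴹ (suc M) (if does (b′ ≟B false) then just ev else nothing)
                 + weightᴹ (suc M) (if does (b′ ≟B true) then just ev else nothing)
                 ≡ weight M ev + weight M ev
    split false = trans (+-identityʳ _) (weight-suc ev |ev|≤M)
    split true  = weight-suc ev |ev|≤M
  ... | no  _ rewrite weightᴹ-∷ M (k , b′) (restrict e false ev) | weightᴹ-∷ M (k , b′) (restrict e true ev) =
    restrict-weight e M ev |ev|≤M

  totalWeight-condition-∷ : ∀ e b M ev evs →
    totalWeight M (condition e b (ev ∷ evs)) ≡ weightᴹ M (restrict e b ev) + totalWeight M (condition e b evs)
  totalWeight-condition-∷ e b M ev evs with restrict e b ev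
  ... | just _  = refl
  ... | nothing = refl

  condition-weight : ∀ e M evs → All (λ ev → length ev ≤ M) evs →
    totalWeight M (condition e false evs) + totalWeight M (condition e true evs) ≡ totalWeight M evs + totalWeight M evs
  condition-weight e M [] [] = refl
  condition-weight e M (ev ∷ evs) (|ev|≤M ∷ lengths) = begin
    totalWeight M (condition e false (ev ∷ evs)) + totalWeight M (condition e true (ev ∷ evs))
      ≡⟨ cong₂ _+_ (totalWeight-condition-∷ e false M ev evs) (totalWeight-condition-∷ e true M ev evs) ⟩
    (w₀ + W₀) + (w₁ + W₁)  ≡⟨ +-interchange w₀ W₀ w₁ W₁ ⟩
    (w₀ + w₁) + (W₀ + W₁)  ≡⟨ cong₂ _+_ (restrict-weight e M ev |ev|≤M) (condition-weight e M evs lengths) ⟩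
    (w + w) + (W + W)      ≡⟨ +-interchange w w W W ⟩
    (w + W) + (w + W)      ∎
    where
    open ≡-Reasoning
    w₀ = weightᴹ M (restrict e false ev)
    w₁ = weightᴹ M (restrict e true ev)
    W₀ = totalWeight M (condition e false evs)
    W₁ = totalWeight M (condition e true evs)
    w = weight M ev
    W = totalWeight M evs

  condition-wellFormed : ∀ {e b E M evs} → All (WellFormed (e ∷ E) M) evs →
                         All (WellFormed E M) (condition e b evs)
  condition-wellFormed wf = All.mapMaybe⁺ (All.map⁺ (All.map restrict-wellFormed wf))

  condition-avoided : ∀ e b χ {evs} → All DistinctKeys evs →
    All (λ ev → ¬ Holds χ ev) (condition e b evs) → All (λ ev → ¬ Holds (set e b χ) ev) evs
  condition-avoided e b χ [] _ = []
  condition-avoided e b χ {ev ∷ evs} (distinct ∷ distincts) avoided =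
    (λ holds → All-Any-contradiction avoidedHead (restrict-holds distinct holds)) ∷
    condition-avoided e b χ distincts avoidedTail
    where
    avoidedHead = proj₁ (All-mapMaybe-∷ (restrict e b) ev evs avoided)
    avoidedTail = proj₂ (All-mapMaybe-∷ (restrict e b) ev evs avoided)

  avoid-all : ∀ E M evs → All (WellFormed E M) evs → totalWeight M evs < 2 ^ M →
              ∃[ χ ] All (λ ev → ¬ Holds χ ev) evs
  avoid-all [] M [] _ _ = (λ _ → true) , []
  avoid-all [] M ([] ∷ evs) _ small = ⊥-elim (m+n≮m (2 ^ M) (totalWeight M evs) small)
  avoid-all [] M ((l ∷ ev) ∷ evs) ((_ , _ , () ∷ _) ∷ _) _
  avoid-all (e ∷ E) M evs wf small =
    [ fix false , fix true ]′ (half-below (≤-reflexive (condition-weight e M evs (All.map proj₁ wf))) small)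
    where
    fix : ∀ b → totalWeight M (condition e b evs) < 2 ^ M → ∃[ χ ] All (λ ev → ¬ Holds χ ev) evs
    fix b small′ with avoid-all E M (condition e b evs) (condition-wellFormed wf) small′
    ... | χ , avoided = set e b χ , condition-avoided e b χ (All.map (proj₁ ∘ proj₂) wf) avoided

Word : Set
Word = List Bool

_≟W_ : DecidableEquality Word
_≟W_ = List-≡-dec _≟B_

sameBit : Bool → Bool → Bool
sameBit true  true  = true
sameBit false false = true
sameBit true  false = false
sameBit false true  = false

sameBit-refl : ∀ x → sameBit x x ≡ true
sameBit-refl true  = refl
sameBit-refl false = refl

sameBit-not : ∀ x → sameBit x (not x) ≡ false
sameBit-not true  = refl
sameBit-not false = refl

-- The colour G_c prescribes to the pair {a, b} when a is the shorter word
-- (true = blue, false = red): a and b agree before the last position k of a,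
-- and the colour records whether they agree at position k.  `nothing` means
-- G_c puts no constraint on the ordered pair (a, b).
forced : Word → Word → Maybe Bool
forced (x ∷ [])         (y ∷ _ ∷ _) = just (sameBit x y)
forced (x ∷ a@(_ ∷ _))  (y ∷ b)     = if sameBit x y then forced a b else nothing
forced _                _           = nothing

forced-shorter : ∀ a b {z} → forced a b ≡ just z → length a < length b
forced-shorter (x ∷ [])        (y ∷ _ ∷ _) _ = s≤s (s≤s z≤n)
forced-shorter (x ∷ a@(_ ∷ _)) (y ∷ b) eq with sameBit x y
... | true = s≤s (forced-shorter a b eq)
forced-shorter (x ∷ _ ∷ _)     (y ∷ b) eq | false with () ← eq
forced-shorter []              _           ()
forced-shorter (x ∷ [])        []          ()
forced-shorter (x ∷ [])        (y ∷ [])    ()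
forced-shorter (x ∷ _ ∷ _)     []          ()

forced-one-way : ∀ a b {z} → forced a b ≡ just z → forced b a ≡ nothing
forced-one-way a b a→b with forced b a in b→a
... | nothing = refl
... | just _  = ⊥-elim (<-asym (forced-shorter a b a→b) (forced-shorter b a b→a))

forced-∷ : ∀ y x a b → forced (y ∷ x ∷ a) (y ∷ b) ≡ forced (x ∷ a) b
forced-∷ y x a b rewrite sameBit-refl y = refl

forced-edge : ∀ p x x′ r rs → forced (p ++ [ x ]) (p ++ x′ ∷ r ∷ rs) ≡ just (sameBit x x′)
forced-edge []            x x′ r rs = refl
forced-edge (y ∷ [])      x x′ r rs = trans (forced-∷ y x [] (x′ ∷ r ∷ rs)) (forced-edge [] x x′ r rs)
forced-edge (y ∷ z ∷ p)   x x′ r rs = trans (forced-∷ y z (p ++ [ x ]) ((z ∷ p) ++ x′ ∷ r ∷ rs)) (forced-edge (z ∷ p) x x′ r rs)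

blue-forced : ∀ {a b} → BlueRel a b → forced a b ≡ just true
blue-forced (blue p x r rs) = trans (forced-edge p x x r rs) (cong just (sameBit-refl x))

red-forced : ∀ {a b} → RedRel a b → forced a b ≡ just false
red-forced (red p x r rs) = trans (forced-edge p x (not x) r rs) (cong just (sameBit-not x))

-- Unordered pairs of words are represented by their lexicographically sorted
-- ordered pair; these are the keys of the free bits of the colouring.
PairKey : Set
PairKey = Word × Word

module LexOrder = DecTotalOrder (Lex-≤-decTotalOrder Bool-≤-decTotalOrder)

pairKey : Word → Word → PairKey
pairKey a b with a LexOrder.≤? b
... | yes _ = a , b
... | no  _ = b , a

pairKey-sym : ∀ a b → pairKey a b ≡ pairKey b a
pairKey-sym a b with a LexOrder.≤? b | b LexOrder.≤? a
... | yes a≤b | yes b≤a rewrite Pointwise-≡⇒≡ (LexOrder.antisym a≤b b≤a) = refl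
... | yes _   | no  _   = refl
... | no  _   | yes _   = refl
... | no  a≰b | no  b≰a with LexOrder.total a b
...   | inj₁ a≤b = ⊥-elim (a≰b a≤b)
...   | inj₂ b≤a = ⊥-elim (b≰a b≤a)

pairKey-cases : ∀ a b → pairKey a b ≡ (a , b) ⊎ pairKey a b ≡ (b , a)
pairKey-cases a b with a LexOrder.≤? b
... | yes _ = inj₁ refl
... | no  _ = inj₂ refl

pairKey-≡ : ∀ {a b c d} → pairKey a b ≡ (c , d) → (a ≡ c × b ≡ d) ⊎ (a ≡ d × b ≡ c)
pairKey-≡ {a} {b} eq with pairKey-cases a b
... | inj₁ ab with trans (sym ab) eq
...   | refl = inj₁ (refl , refl)
pairKey-≡ {a} {b} eq | inj₂ ba with trans (sym ba) eq
...   | refl = inj₂ (refl , refl)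

pairColour : Maybe Bool → Maybe Bool → Bool → Bool
pairColour (just z) _        _    = z
pairColour nothing  (just z) _    = z
pairColour nothing  nothing  free = free

adjacency : (PairKey → Bool) → Word → Word → Bool
adjacency χ a b with a ≟W b
... | yes _ = false
... | no  _ = pairColour (forced a b) (forced b a) (χ (pairKey a b))

adjacency-sym : ∀ χ a b → adjacency χ a b ≡ adjacency χ b a
adjacency-sym χ a b with a ≟W b | b ≟W a
... | yes _    | yes _    = refl
... | yes refl | no  a≢a  = ⊥-elim (a≢a refl)
... | no  a≢a  | yes refl = ⊥-elim (a≢a refl)
... | no  _    | no  _    rewrite pairKey-sym a b = swap (forced a b) (forced b a) (forced-one-way a b)
  where
  swap : ∀ m m′ {free} → (∀ {z} → m ≡ just z → m′ ≡ nothing) → pairColour m m′ free ≡ pairColour m′ m free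
  swap (just _) (just _) one-way with () ← one-way refl
  swap (just _) nothing  _ = refl
  swap nothing  (just _) _ = refl
  swap nothing  nothing  _ = refl

adjacency-irrefl : ∀ χ a → adjacency χ a a ≡ false
adjacency-irrefl χ a with a ≟W a
... | yes _   = refl
... | no  a≢a = ⊥-elim (a≢a refl)

adjacency-forced : ∀ χ a b {z} → forced a b ≡ just z → adjacency χ a b ≡ z
adjacency-forced χ a b a→b with a ≟W b
... | yes refl = ⊥-elim (<-irrefl refl (forced-shorter a a a→b))
... | no  _ rewrite a→b = refl

adjacency-free : ∀ χ a b → a ≢ b → forced a b ≡ nothing → forced b a ≡ nothing →
                 adjacency χ a b ≡ χ (pairKey a b)
adjacency-free χ a b a≢b a↛b b↛a with a ≟W b
... | yes a≡b = ⊥-elim (a≢b a≡b)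
... | no  _ rewrite a↛b | b↛a = refl

graphOf : (PairKey → Bool) → SimpleGraph
graphOf χ = record { adj = adjacency χ ; sym = adjacency-sym χ ; irrefl = adjacency-irrefl χ }

graphOf-type : ∀ c χ → IsOfTypeGc c (graphOf χ)
graphOf-type c χ = (λ a b _ _ blue-ab → adjacency-forced χ a b (blue-forced blue-ab))
                 , (λ a b _ _ red-ab  → adjacency-forced χ a b (red-forced red-ab))

_≟K_ : DecidableEquality PairKey
_≟K_ = ×-≡-dec _≟W_ _≟W_

_≟M_ : DecidableEquality (Maybe Bool)
_≟M_ = Maybe-≡-dec _≟B_

open EventAvoidance _≟K_

Free : Word → Word → Set
Free a b = forced a b ≡ nothing × forced b a ≡ nothing

free? : ∀ a b → Dec (Free a b)
free? a b = (forced a b ≟M nothing) ×-dec (forced b a ≟M nothing)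

ForcedTo : Bool → Word → Word → Set
ForcedTo β a b = forced a b ≡ just β

forcedTo? : ∀ β a b → Dec (ForcedTo β a b)
forcedTo? β a b = forced a b ≟M just β

-- Pairs whose forced colour, if any, is β: the pairs inside a set that is
-- homogeneous of colour β in a graph of type G_c.
Compatible : Bool → Word → Word → Set
Compatible β a b = MaybeAll.All (_≡ β) (forced a b) × MaybeAll.All (_≡ β) (forced b a)

compatible? : ∀ β a b → Dec (Compatible β a b)
compatible? β a b = MaybeAll.dec (_≟B β) (forced a b) ×-dec MaybeAll.dec (_≟B β) (forced b a)

compatible-cases : ∀ {β a b} → Compatible β a b → (Free a b ⊎ ForcedTo β b a) ⊎ ForcedTo β a b
compatible-cases {a = a} {b} (ab , ba) with forced a b | forced b a | ab | ba
... | just _  | _       | MaybeAll.just refl | _                  = inj₂ refl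
... | nothing | just _  | MaybeAll.nothing   | MaybeAll.just refl = inj₁ (inj₂ refl)
... | nothing | nothing | MaybeAll.nothing   | MaybeAll.nothing   = inj₁ (inj₁ (refl , refl))

homogeneous-compatible : ∀ χ β {a b} → adjacency χ a b ≡ β → Compatible β a b
homogeneous-compatible χ β {a} {b} ab≡β = agrees a b ab≡β , agrees b a (trans (adjacency-sym χ b a) ab≡β)
  where
  agrees : ∀ a b → adjacency χ a b ≡ β → MaybeAll.All (_≡ β) (forced a b)
  agrees a b ab≡β with forced a b in a→b
  ... | nothing = MaybeAll.nothing
  ... | just z  = MaybeAll.just (trans (sym (adjacency-forced χ a b a→b)) ab≡β)

pairCount : ℕ → ℕ
pairCount zero    = 0
pairCount (suc n) = n + pairCount n

-- The bad event of a list T of vertices and a colour β: all free pairs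
-- inside T receive colour β.  A set homogeneous of colour β in the graph
-- built from χ makes its bad event hold under χ.
badEvent : Bool → List Word → Event
badEvent β []      = []
badEvent β (x ∷ T) = map (λ u → pairKey x u , β) (filter (free? x) T) ++ badEvent β T

badEvent-length : ∀ β T → length (badEvent β T) ≤ pairCount (length T)
badEvent-length β [] = z≤n
badEvent-length β (x ∷ T)
  rewrite length-++ (map (λ u → pairKey x u , β) (filter (free? x) T)) {badEvent β T}
        | length-map (λ u → pairKey x u , β) (filter (free? x) T)
  = +-mono-≤ (count-≤ (free? x) T) (badEvent-length β T)

pairKey-∈ : ∀ {V : List Word} {a b} → a ∈ V → b ∈ V → pairKey a b ∈ cartesianProduct V V
pairKey-∈ {V} {a} {b} a∈V b∈V with pairKey-cases a b
... | inj₁ ab rewrite ab = ∈-cartesianProduct⁺ a∈V b∈V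
... | inj₂ ba rewrite ba = ∈-cartesianProduct⁺ b∈V a∈V

badEvent-keys : ∀ β {V} T → All (_∈ V) T → All (λ l → proj₁ l ∈ cartesianProduct V V) (badEvent β T)
badEvent-keys β [] [] = []
badEvent-keys β (x ∷ T) (x∈V ∷ T⊆V) =
  All.++⁺ (All.map⁺ (All.filter⁺ (free? x) (All.map (pairKey-∈ x∈V) T⊆V))) (badEvent-keys β T T⊆V)

badEvent-distinct : ∀ β {T} → Unique T → DistinctKeys (badEvent β T)
badEvent-distinct β {[]} [] = []
badEvent-distinct β {x ∷ T} (x∉T ∷ uniq) =
  AllPairs.++⁺ (AllPairs.map⁺ (AllPairs.filter⁺ (free? x) (AllPairs.map pairKey-injective uniq)))
               (badEvent-distinct β uniq)
               (All.map⁺ (All.filter⁺ (free? x) (All.map (λ _ → All.map new-key old-keys) x∉T)))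
  where
  pairKey-injective : ∀ {u u′} → u ≢ u′ → pairKey x u ≢ pairKey x u′
  pairKey-injective {u} {u′} u≢u′ eq with pairKey-cases x u′
  ... | inj₁ xu′ with pairKey-≡ (trans eq xu′)
  ...   | inj₁ (_ , u≡u′)   = u≢u′ u≡u′
  ...   | inj₂ (x≡u′ , u≡x) = u≢u′ (trans u≡x x≡u′)
  pairKey-injective {u} {u′} u≢u′ eq | inj₂ u′x with pairKey-≡ (trans eq u′x)
  ...   | inj₁ (x≡u′ , u≡x) = u≢u′ (trans u≡x x≡u′)
  ...   | inj₂ (_ , u≡u′)   = u≢u′ u≡u′
  old-keys : All (λ l → proj₁ l ∈ cartesianProduct T T) (badEvent β T)
  old-keys = badEvent-keys β T (All.tabulate (λ u∈T → u∈T))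
  -- x ∉ T, so no key involving x comes from T × T.
  new-key : ∀ {u k} → k ∈ cartesianProduct T T → pairKey x u ≢ k
  new-key {u} {a , b} k∈T² eq with ∈-cartesianProduct⁻ T T k∈T² | pairKey-≡ eq
  ... | a∈T , _ | inj₁ (refl , _) = All.lookup x∉T a∈T refl
  ... | _ , b∈T | inj₂ (refl , _) = All.lookup x∉T b∈T refl

badEvent-holds : ∀ χ β {T} → Unique T → AllPairs (λ a b → adjacency χ a b ≡ β) T → Holds χ (badEvent β T)
badEvent-holds χ β {[]} [] [] = []
badEvent-holds χ β {x ∷ T} (x∉T ∷ uniq) (xT≡β ∷ homogeneous) =
  All.++⁺ (All.map⁺ (All.zipWith free-pair (All.all-filter (free? x) T , All.filter⁺ (free? x) (All.zip (x∉T , xT≡β)))))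
          (badEvent-holds χ β uniq homogeneous)
  where
  free-pair : ∀ {u} → Free x u × (x ≢ u × adjacency χ x u ≡ β) → χ (pairKey x u) ≡ β
  free-pair {u} ((x↛u , u↛x) , x≢u , xu≡β) = trans (sym (adjacency-free χ x u x≢u x↛u u↛x)) xu≡β

pick : Bool → Bool → Bool
pick true  x = x
pick false x = not x

sameBit-pick : ∀ x′ x → x′ ≡ pick (sameBit x′ x) x
sameBit-pick true  true  = refl
sameBit-pick false false = refl
sameBit-pick true  false = refl
sameBit-pick false true  = refl

-- The words forced to colour β against v: one for each proper prefix of v,
-- namely v₁ … v_{i-1} followed by the bit determined by v_i and β.
candidates : Bool → Word → List Word
candidates β []          = []
candidates β (x ∷ [])    = []
candidates β (x ∷ y ∷ r) = [ pick β x ] ∷ map (x ∷_) (candidates β (y ∷ r))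

candidates-length : ∀ β v → length (candidates β v) ≡ length v ∸ 1
candidates-length β []          = refl
candidates-length β (x ∷ [])    = refl
candidates-length β (x ∷ y ∷ r) = cong suc (trans (length-map (x ∷_) (candidates β (y ∷ r))) (candidates-length β (y ∷ r)))

candidates-complete : ∀ β u v → ForcedTo β u v → u ∈ candidates β v
candidates-complete β (x′ ∷ []) (x ∷ _ ∷ _) eq =
  here (cong [_] (trans (sameBit-pick x′ x) (cong (λ β′ → pick β′ x) (just-injective eq))))
candidates-complete β (x′ ∷ a@(_ ∷ _)) (x ∷ b) eq with sameBit x′ x | sameBit-pick x′ x
... | false | _ with () ← eq
... | true  | refl = descend b eq
  where
  descend : ∀ b → ForcedTo β a b → (x ∷ a) ∈ candidates β (x ∷ b)
  descend (y ∷ r) a→b = there (∈-map⁺ (x ∷_) (candidates-complete β a (y ∷ r) a→b))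
  descend [] a→b with () ← forced-shorter a [] a→b
candidates-complete β (_ ∷ []) (_ ∷ []) ()
candidates-complete β (_ ∷ []) [] ()
candidates-complete β [] _ ()

inDegree : Bool → List Word → Word → ℕ
inDegree β S v = count (λ u → forcedTo? β u v) S

inDegree-bound : ∀ β {S} → Unique S → ∀ v → inDegree β S v ≤ length v ∸ 1
inDegree-bound β {S} uniq v = subst (inDegree β S v ≤_) (candidates-length β v)
  (unique-⊆-length (AllPairs.filter⁺ (λ u → forcedTo? β u v) uniq)
                   (All.map (candidates-complete β _ v) (All.all-filter (λ u → forcedTo? β u v) S)))

forcedTotal : Bool → List Word → List Word → ℕ
forcedTotal β T S = sum (map (inDegree β S) T)

forcedTotal-∷ : ∀ β T x S → forcedTotal β T (x ∷ S) ≡ count (forcedTo? β x) T + forcedTotal β T S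
forcedTotal-∷ β [] x S = refl
forcedTotal-∷ β (v ∷ T) x S rewrite forcedTotal-∷ β T x S with does (forcedTo? β x v)
... | true  = cong suc (+-left-comm (inDegree β S v) (count (forcedTo? β x) T) (forcedTotal β T S))
... | false = +-left-comm (inDegree β S v) (count (forcedTo? β x) T) (forcedTotal β T S)

-- Forced pairs are counted by forcedTotal, so the bad event
-- contains all but at most forcedTotal β T T of the pairs of T.
free-pairs : ∀ β T → AllPairs (Compatible β) T → pairCount (length T) ≤ length (badEvent β T) + forcedTotal β T T
free-pairs β [] [] = z≤n
free-pairs β (x ∷ T) (compat ∷ compats) = begin
  length T + pairCount (length T)  ≤⟨ +-mono-≤ classify (free-pairs β T compats) ⟩
  (F + I + O) + (E + G)            ≡⟨ rearrange F I O E G ⟩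
  (F + E) + (I + (O + G))          ≤⟨ +-mono-≤ (≤-reflexive (sym new-length)) (+-monoˡ-≤ (O + G) (count-≤-∷ (λ u → forcedTo? β u x) x T)) ⟩
  length (badEvent β (x ∷ T)) + (inDegree β (x ∷ T) x + (O + G))
                                   ≡⟨ cong (λ n → length (badEvent β (x ∷ T)) + (inDegree β (x ∷ T) x + n)) (sym (forcedTotal-∷ β T x T)) ⟩
  length (badEvent β (x ∷ T)) + forcedTotal β (x ∷ T) (x ∷ T) ∎
  where
  open ≤-Reasoning
  F = count (free? x) T
  I = count (λ u → forcedTo? β u x) T
  O = count (forcedTo? β x) T
  E = length (badEvent β T)
  G = forcedTotal β T T
  classify : length T ≤ F + I + O
  classify = begin
    length T ≡⟨ sym (count-all (λ u → (free? x u ⊎-dec forcedTo? β u x) ⊎-dec forcedTo? β x u) (All.map (compatible-cases {β} {x}) compat)) ⟩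
    count (λ u → (free? x u ⊎-dec forcedTo? β u x) ⊎-dec forcedTo? β x u) T
      ≤⟨ count-⊎ (λ u → free? x u ⊎-dec forcedTo? β u x) (forcedTo? β x) T ⟩
    count (λ u → free? x u ⊎-dec forcedTo? β u x) T + O
      ≤⟨ +-monoˡ-≤ O (count-⊎ (free? x) (λ u → forcedTo? β u x) T) ⟩
    F + I + O ∎
  new-length : length (badEvent β (x ∷ T)) ≡ F + E
  new-length = trans (length-++ (map (λ u → pairKey x u , β) (filter (free? x) T)))
                     (cong (_+ E) (length-map (λ u → pairKey x u , β) (filter (free? x) T)))
  rearrange : ∀ f i o e g → (f + i + o) + (e + g) ≡ (f + e) + (i + (o + g))
  rearrange = solve-∀

-- The weight of a vertex: 2^(|v| - 1) bounds the number of words forced against it.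
vertexWeight : Word → ℕ
vertexWeight v = 2 ^ (length v ∸ 1)

badEvent-weight : ∀ β {T} → Unique T → AllPairs (Compatible β) T →
                  weight (pairCount (length T)) (badEvent β T) ≤ product (map vertexWeight T)
badEvent-weight β {T} uniq compat = begin
  2 ^ (pairCount (length T) ∸ length (badEvent β T))
    ≤⟨ ^-monoʳ-≤ 2 (m≤n+o⇒m∸n≤o (pairCount (length T)) (length (badEvent β T))
                      (≤-trans (free-pairs β T compat) (+-monoʳ-≤ (length (badEvent β T)) forced-bound))) ⟩
  2 ^ sum (map (λ v → length v ∸ 1) T)  ≡⟨ ^-sum 2 (λ v → length v ∸ 1) T ⟩
  product (map vertexWeight T)           ∎
  where
  open ≤-Reasoning
  forced-bound : forcedTotal β T T ≤ sum (map (λ v → length v ∸ 1) T)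
  forced-bound = sum-map-mono (All.universal (inDegree-bound β uniq) T)

words : ℕ → List Word
words zero    = [ [] ]
words (suc n) = map (true ∷_) (words n) ++ map (false ∷_) (words n)

words-complete : ∀ s → s ∈ words (length s)
words-complete []          = here refl
words-complete (true ∷ s)  = ∈-++⁺ˡ (∈-map⁺ (true ∷_) (words-complete s))
words-complete (false ∷ s) = ∈-++⁺ʳ _ (∈-map⁺ (false ∷_) (words-complete s))

words-length : ∀ n → All (λ v → length v ≡ n) (words n)
words-length zero    = refl ∷ []
words-length (suc n) = All.++⁺ (All.map⁺ (All.map (cong suc) (words-length n)))
                               (All.map⁺ (All.map (cong suc) (words-length n)))

words-count : ∀ n → length (words n) ≡ 2 ^ n
words-count zero    = refl
words-count (suc n) = begin
  length (map (true ∷_) (words n) ++ map (false ∷_) (words n))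
    ≡⟨ length-++ (map (true ∷_) (words n)) ⟩
  length (map (true ∷_) (words n)) + length (map (false ∷_) (words n))
    ≡⟨ cong₂ _+_ (length-map (true ∷_) (words n)) (length-map (false ∷_) (words n)) ⟩
  length (words n) + length (words n)
    ≡⟨ cong (λ m → m + m) (words-count n) ⟩
  2 ^ n + 2 ^ n
    ≡⟨ cong (2 ^ n +_) (sym (+-identityʳ (2 ^ n))) ⟩
  2 ^ suc n ∎
  where open ≡-Reasoning

shortWords : ℕ → List Word
shortWords zero    = []
shortWords (suc n) = shortWords n ++ words (suc n)

shortWords-complete : ∀ n s → 1 ≤ length s → length s ≤ n → s ∈ shortWords n
shortWords-complete zero    s 1≤|s| |s|≤0 with () ← ≤-trans 1≤|s| |s|≤0
shortWords-complete (suc n) s 1≤|s| |s|≤1+n with m≤n⇒m<n∨m≡n |s|≤1+n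
... | inj₁ |s|<1+n = ∈-++⁺ˡ (shortWords-complete n s 1≤|s| (s≤s⁻¹ |s|<1+n))
... | inj₂ |s|≡1+n = ∈-++⁺ʳ (shortWords n) (subst (λ m → s ∈ words m) |s|≡1+n (words-complete s))

-- A list containing every vertex of G_{k+1}: the words of length at most k
-- and the words of length k + 1 ending with 0.
vertices : ℕ → List Word
vertices k = shortWords k ++ map (_++ [ false ]) (words k)

vertices-complete : ∀ k s → IsVertex (suc k) s → s ∈ vertices k
vertices-complete k s (1≤|s| , |s|≤1+k , ends-with-0) with m≤n⇒m<n∨m≡n |s|≤1+k
... | inj₁ |s|<1+k = ∈-++⁺ˡ (shortWords-complete k s 1≤|s| (s≤s⁻¹ |s|<1+k))
... | inj₂ |s|≡1+k with ends-with-0 |s|≡1+k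
...   | p , refl = ∈-++⁺ʳ (shortWords k) (∈-map⁺ (_++ [ false ]) (subst (λ m → p ∈ words m) |p|≡k (words-complete p)))
  where
  |p|≡k : length p ≡ k
  |p|≡k = suc-injective (trans (sym (trans (length-++ p) (+-comm (length p) 1))) |s|≡1+k)

words-weight : ∀ n → sum (map vertexWeight (words n)) ≡ 2 ^ n * 2 ^ (n ∸ 1)
words-weight n = trans (sum-map-const vertexWeight (All.map (cong (λ m → 2 ^ (m ∸ 1))) (words-length n)))
                       (cong (_* 2 ^ (n ∸ 1)) (words-count n))

-- Σ_{1 ≤ |v| ≤ n} 2^(|v| - 1) ≤ 4^n, by induction: 4^n + 2^(n+1) 2^n ≤ 4^(n+1).
shortWords-weight : ∀ n → sum (map vertexWeight (shortWords n)) ≤ 2 ^ n * 2 ^ n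
shortWords-weight zero    = z≤n
shortWords-weight (suc n) = begin
  sum (map vertexWeight (shortWords n ++ words (suc n)))
    ≡⟨ sum-map-++ vertexWeight (shortWords n) (words (suc n)) ⟩
  sum (map vertexWeight (shortWords n)) + sum (map vertexWeight (words (suc n)))
    ≤⟨ +-mono-≤ (shortWords-weight n) (≤-reflexive (words-weight (suc n))) ⟩
  a * a + 2 ^ suc n * a
    ≤⟨ m≤m+n (a * a + 2 ^ suc n * a) (a * a) ⟩
  a * a + 2 ^ suc n * a + a * a
    ≡⟨ four-squares a ⟩
  2 ^ suc n * 2 ^ suc n ∎
  where
  open ≤-Reasoning
  a = 2 ^ n
  four-squares : ∀ a → a * a + (2 * a) * a + a * a ≡ (2 * a) * (2 * a)
  four-squares = solve-∀

vertices-weight : ∀ k → sum (map vertexWeight (vertices k)) ≤ 2 ^ suc (k + k)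
vertices-weight k = begin
  sum (map vertexWeight (vertices k))
    ≡⟨ sum-map-++ vertexWeight (shortWords k) (map (_++ [ false ]) (words k)) ⟩
  sum (map vertexWeight (shortWords k)) + sum (map vertexWeight (map (_++ [ false ]) (words k)))
    ≤⟨ +-mono-≤ (shortWords-weight k) (≤-reflexive top-weight) ⟩
  2 ^ k * 2 ^ k + 2 ^ k * 2 ^ k
    ≡⟨ cong (λ m → m + m) (sym (^-distribˡ-+-* 2 k k)) ⟩
  2 ^ (k + k) + 2 ^ (k + k)
    ≡⟨ cong (2 ^ (k + k) +_) (sym (+-identityʳ (2 ^ (k + k)))) ⟩
  2 ^ suc (k + k) ∎
  where
  open ≤-Reasoning
  top-weight : sum (map vertexWeight (map (_++ [ false ]) (words k))) ≡ 2 ^ k * 2 ^ k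
  top-weight = begin-equality
    sum (map vertexWeight (map (_++ [ false ]) (words k)))
      ≡⟨ sum-map-const vertexWeight (All.map⁺ (All.map (λ {v} |v|≡k → cong (2 ^_) (trans (cong (_∸ 1) (length-++ v)) (trans (m+n∸n≡m (length v) 1) |v|≡k))) (words-length k))) ⟩
    length (map (_++ [ false ]) (words k)) * 2 ^ k
      ≡⟨ cong (_* 2 ^ k) (trans (length-map (_++ [ false ]) (words k)) (words-count k)) ⟩
    2 ^ k * 2 ^ k ∎

pairCount-double : ∀ n → 2 * pairCount n + n ≡ n * n
pairCount-double zero    = refl
pairCount-double (suc n) = trans (step n (pairCount n)) (trans (cong (λ m → m + (2 * n + 1)) (pairCount-double n)) (square n))
  where
  step : ∀ n p → 2 * (n + p) + suc n ≡ 2 * p + n + (2 * n + 1)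
  step = solve-∀
  square : ∀ n → n * n + (2 * n + 1) ≡ suc n * suc n
  square = solve-∀

-- For t = 4c the budget C(t, 2) exceeds (2c - 1) t + 1, the logarithm of
-- the total weight of the bad events.
budget-large : ∀ k → suc (suc (k + k) * (4 * suc k)) < pairCount (4 * suc k)
budget-large k = *-cancelˡ-≤ 2 (+-cancelʳ-≤ t (2 * a) (2 * pairCount t) (begin
  2 * a + t          ≤⟨ +-monoˡ-≤ t (m≤m+n (2 * a) (4 * k)) ⟩
  2 * a + 4 * k + t  ≡⟨ expand k ⟩
  t * t              ≡⟨ sym (pairCount-double t) ⟩
  2 * pairCount t + t ∎))
  where
  open ≤-Reasoning
  t = 4 * suc k
  a = suc (suc (suc (k + k) * t))
  expand : ∀ k → 2 * suc (suc (suc (k + k) * (4 * suc k))) + 4 * k + 4 * suc k ≡ (4 * suc k) * (4 * suc k)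
  expand = solve-∀

-- The construction for c = k + 1: homogeneous sets of size t = 4c are the bad
-- events, and an assignment of the free bits avoiding all of them exists.
module Construction (k : ℕ) where

  t : ℕ
  t = 4 * suc k

  budget : ℕ
  budget = pairCount t

  V : List Word
  V = vertices k

  Candidate : Bool → List Word → Set
  Candidate β T = Unique T × AllPairs (Compatible β) T

  candidate? : ∀ β T → Dec (Candidate β T)
  candidate? β T = unique? T ×-dec AllPairs.allPairs? (compatible? β) T

  candidateTuples : Bool → List (List Word)
  candidateTuples β = filter (candidate? β) (tuples V t)

  badEventsOf : Bool → List Event
  badEventsOf β = map (badEvent β) (candidateTuples β)

  badEvents : List Event
  badEvents = badEventsOf true ++ badEventsOf false

  candidateTuples-sound : ∀ β → All (λ T → (All (_∈ V) T × length T ≡ t) × Candidate β T) (candidateTuples β)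
  candidateTuples-sound β = All.zip (All.filter⁺ (candidate? β) (tuples-sound V t) , All.all-filter (candidate? β) (tuples V t))

  badEventsOf-wellFormed : ∀ β → All (WellFormed (cartesianProduct V V) budget) (badEventsOf β)
  badEventsOf-wellFormed β = All.map⁺ (All.map wellFormed (candidateTuples-sound β))
    where
    wellFormed : ∀ {T} → (All (_∈ V) T × length T ≡ t) × Candidate β T → WellFormed (cartesianProduct V V) budget (badEvent β T)
    wellFormed {T} ((T⊆V , |T|≡t) , uniq , _) =
      subst (λ n → length (badEvent β T) ≤ pairCount n) |T|≡t (badEvent-length β T) ,
      badEvent-distinct β uniq , badEvent-keys β T T⊆V

  badEventsOf-weight : ∀ β → totalWeight budget (badEventsOf β) ≤ 2 ^ (suc (k + k) * t)
  badEventsOf-weight β = begin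
    totalWeight budget (badEventsOf β)
      ≡⟨ cong sum (sym (map-∘ (candidateTuples β))) ⟩
    sum (map (weight budget ∘ badEvent β) (candidateTuples β))
      ≤⟨ sum-map-mono (All.map (λ { {T} ((_ , |T|≡t) , uniq , compat) →
           subst (λ n → weight (pairCount n) (badEvent β T) ≤ product (map vertexWeight T)) |T|≡t (badEvent-weight β uniq compat) }) (candidateTuples-sound β)) ⟩
    sum (map (product ∘ map vertexWeight) (candidateTuples β))
      ≤⟨ sum-map-filter (product ∘ map vertexWeight) (candidate? β) (tuples V t) ⟩
    sum (map (product ∘ map vertexWeight) (tuples V t))
      ≡⟨ sum-product-tuples vertexWeight V t ⟩
    sum (map vertexWeight V) ^ t
      ≤⟨ ^-monoˡ-≤ t (vertices-weight k) ⟩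
    (2 ^ suc (k + k)) ^ t
      ≡⟨ ^-*-assoc 2 (suc (k + k)) t ⟩
    2 ^ (suc (k + k) * t) ∎
    where open ≤-Reasoning

  badEvents-weight : totalWeight budget badEvents < 2 ^ budget
  badEvents-weight = begin-strict
    totalWeight budget badEvents
      ≡⟨ sum-map-++ (weight budget) (badEventsOf true) (badEventsOf false) ⟩
    totalWeight budget (badEventsOf true) + totalWeight budget (badEventsOf false)
      ≤⟨ +-mono-≤ (badEventsOf-weight true) (badEventsOf-weight false) ⟩
    2 ^ (suc (k + k) * t) + 2 ^ (suc (k + k) * t)
      ≡⟨ cong (2 ^ (suc (k + k) * t) +_) (sym (+-identityʳ _)) ⟩
    2 ^ suc (suc (k + k) * t)
      <⟨ ^-monoʳ-< 2 (s≤s (s≤s z≤n)) (budget-large k) ⟩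
    2 ^ budget ∎
    where open ≤-Reasoning

  colouring : ∃[ χ ] All (λ ev → ¬ Holds χ ev) badEvents
  colouring = avoid-all (cartesianProduct V V) budget badEvents
                (All.++⁺ (badEventsOf-wellFormed true) (badEventsOf-wellFormed false)) badEvents-weight

  badEventsOf-⊆ : ∀ β {ev} → ev ∈ badEventsOf β → ev ∈ badEvents
  badEventsOf-⊆ true  = ∈-++⁺ˡ
  badEventsOf-⊆ false = ∈-++⁺ʳ (badEventsOf true)

  -- If χ avoids the bad events, the graph built from χ has no homogeneous
  -- set of t vertices: its first t elements would form a candidate tuple
  -- whose bad event holds.
  homogeneous-small : ∀ χ → All (λ ev → ¬ Holds χ ev) badEvents → ∀ β S →
    All (IsVertex (suc k)) S → Unique S → AllPairs (λ a b → adjacency χ a b ≡ β) S → length S < t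
  homogeneous-small χ avoided β S S-vertices uniq homogeneous with length S <? t
  ... | yes |S|<t = |S|<t
  ... | no  |S|≮t = ⊥-elim (All.lookup avoided (badEventsOf-⊆ β (∈-map⁺ (badEvent β) (∈-filter⁺ (candidate? β) T∈tuples candidate)))
                      (badEvent-holds χ β (AllPairs.take⁺ t uniq) (AllPairs.take⁺ t homogeneous)))
    where
    T = take t S
    |T|≡t : length T ≡ t
    |T|≡t = trans (length-take t S) (m≤n⇒m⊓n≡m (≮⇒≥ |S|≮t))
    T∈tuples : T ∈ tuples V t
    T∈tuples = subst (λ n → T ∈ tuples V n) |T|≡t
                 (tuples-complete (All.take⁺ t (All.map (vertices-complete k _) S-vertices)))
    candidate : Candidate β T
    candidate = AllPairs.take⁺ t uniq , AllPairs.take⁺ t (AllPairs.map (λ {a} {b} → homogeneous-compatible χ β {a} {b}) homogeneous)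

lemma2 : ∃ λ c₀ → ∀ (c : ℕ) → c₀ ≤ c → ∃ λ (G : SimpleGraph) → IsOfTypeGc c G × AlphaLt c G (4 * c) × OmegaLt c G (4 * c)
lemma2 = 1 , λ where
  (suc k) _ → let open Construction k
                  (χ , avoided) = colouring
              in graphOf χ , graphOf-type (suc k) χ
               , (λ S (S-vertices , uniq , independent) → homogeneous-small χ avoided false S S-vertices uniq independent)
               , (λ S (S-vertices , uniq , clique) → homogeneous-small χ avoided true S S-vertices uniq clique)
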